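{- For all $m,n\in\mathbb{N}$ with $m\mid n$, every $\beta\in(0,1)$ and every $\sigma\in S_n$, there exists $\tau\in S_n$ such that $C_1(\tau)\supseteq C_1(\sigma)$, $w(\tau)\le\lceil m^\beta\rceil$, and $d(\sigma,\tau)\le\frac{8}{m^\beta}$.
   Context: $S_n$ is the symmetric group on $\{1,\dots,n\}$ with normalized Hamming distance $d(\sigma,\tau)=\frac1n|\{i:\sigma(i)\ne\tau(i)\}|$. For $\sigma\in S_n$ and $l\ge1$, $C_l(\sigma)$ is the set of cycles of $\sigma$ of length $l$ (so $C_1(\sigma)$ is the set of fixed points), and $w(\sigma)$ is the greatest $l$ with $C_l(\sigma)\ne\varnothing$. $\lceil r\rceil$ is the least integer $\ge r$. -}

module Defs where

open import Data.Nat using (ℕ; zero; suc; _⊔_)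
open import Data.Fin using (Fin)
open import Data.Fin.Properties using (_≟_)
open import Data.Fin.Permutation using (Permutation′; _⟨$⟩ʳ_)
open import Data.List using (List; length; filter; foldr; map; allFin)
open import Relation.Nullary using (yes; no; ¬?)

iter : ∀ {n} → Permutation′ n → ℕ → Fin n → Fin n
iter τ zero    i = i
iter τ (suc l) i = τ ⟨$⟩ʳ iter τ l i

-- least l in {start, start+1, ..., start+fuel-1} with τ^l(i) = i
-- (returns start+fuel if none; never happens for the use below)
search : ∀ {n} → Permutation′ n → Fin n → ℕ → ℕ → ℕ
search τ i start zero = start
search τ i start (suc fuel) with iter τ start i ≟ i
... | yes _ = start
... | no  _ = search τ i (suc start) fuel

-- length of the cycle of τ containing i: least l ≥ 1 with τ^l(i) = i
-- (such l always exists in {1,…,n})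
cycleLength : ∀ {n} → Permutation′ n → Fin n → ℕ
cycleLength {n} τ i = search τ i 1 n

w : ∀ {n} → Permutation′ n → ℕ
w {n} τ = foldr _⊔_ 0 (map (cycleLength τ) (allFin n))

FixSubset : ∀ {n} → Permutation′ n → Permutation′ n → Set
FixSubset σ τ = ∀ i → σ ⟨$⟩ʳ i ≡ i → τ ⟨$⟩ʳ i ≡ i
  where open import Relation.Binary.PropositionalEquality using (_≡_)

-- Hamming count |{i : σ(i) ≠ τ(i)}|, so that d(σ,τ) = hamming σ τ / n
hamming : ∀ {n} → Permutation′ n → Permutation′ n → ℕ
hamming {n} σ τ = length (filter (λ i → ¬? (σ ⟨$⟩ʳ i ≟ τ ⟨$⟩ʳ i)) (allFin n))

{-# OPTIONS --safe #-}
module Submission where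

open import Defs
open import Data.Nat using (ℕ; _*_; _≤_)
open import Data.Nat.Divisibility using (_∣_)
open import Data.Fin.Permutation using (Permutation′)
open import Data.Product using (Σ; _×_)

open import Data.Nat using (zero; suc; _+_; _<_; _⊔_; z≤n; s≤s)
open import Data.Nat.Properties hiding (_≟_)
open import Data.Nat.Divisibility using (∣⇒≤)
open import Data.Fin using (Fin; toℕ)
open import Data.Fin.Properties using (_≟_; all?; ¬∀⟶∃¬; nonZeroIndex; injective⇒≤; toℕ-injective; toℕ<n)
open import Data.Fin.Permutation using (_⟨$⟩ʳ_; _⟨$⟩ˡ_; inverseʳ; inverseˡ; transpose; _∘ₚ_)
import Data.Fin.Permutation.Components as PC
open import Data.List using (List; []; _∷_; length; filter; allFin; lookup)
open import Data.List.Properties using (length-filter; length-tabulate; filter-accept; filter-none; foldr-preservesᵇ)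
open import Data.List.Membership.Propositional using (_∈_)
open import Data.List.Membership.Propositional.Properties using (∈-filter⁺; ∈-allFin)
import Data.List.Relation.Unary.All as All
open import Data.List.Relation.Unary.All.Properties using (map⁺)
open import Data.List.Relation.Unary.AllPairs using ([]; _∷_)
open import Data.List.Relation.Unary.Any using (index)
open import Data.List.Relation.Unary.Any.Properties using (lookup-index)
open import Data.List.Relation.Unary.Unique.Propositional using (Unique)
open import Data.List.Relation.Unary.Unique.Propositional.Properties using (allFin⁺)
open import Data.Product using (_,_; ∃; proj₁; proj₂)
open import Data.Sum using (_⊎_; inj₁; inj₂)
open import Function using (_∘_)
open import Function.Definitions using (Injective)
open import Level using (0ℓ)
open import Relation.Binary.Definitions using (tri<; tri≈; tri>)
open import Relation.Binary.PropositionalEquality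
open import Relation.Nullary using (yes; no; ¬_; ¬?; contradiction)
open import Relation.Unary using (Pred; Decidable; _⊆_; _∪_; _∩_; ∁)
open import Relation.Unary.Properties using (_∩?_; ∁?)

-- Cut long cycles greedily. If i lies on a cycle of length > k, composing π with the
-- transposition of x = πᵏ⁻¹ i and y = π⁻¹ i closes the arc i, π i, …, x into a k-cycle;
-- every other point keeps its image. Such a cut changes at most 2 values, leaves the points
-- on cycles of length ≤ k (in particular the fixed points) untouched, and adds the k points
-- of the arc to them. Hence k · hamming σ π ≤ 2 · #{points on cycles of length ≤ k} is
-- invariant, and once all cycles are short it gives k · hamming σ τ ≤ 2n.

module _ {A : Set} where

  count : {P : Pred A 0ℓ} → Decidable P → List A → ℕ
  count P? xs = length (filter P? xs)

  module _ {P : Pred A 0ℓ} (P? : Decidable P) where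

    count-accept : ∀ {x} xs → P x → count P? (x ∷ xs) ≡ suc (count P? xs)
    count-accept xs p = cong length (filter-accept P? p)

    count-≤-∷ : ∀ x xs → count P? xs ≤ count P? (x ∷ xs)
    count-≤-∷ x xs with P? x
    ... | yes _ = n≤1+n _
    ... | no _ = ≤-refl

    count≤1 : ∀ {xs} → Unique xs → (∀ {x y} → P x → P y → x ≡ y) → count P? xs ≤ 1
    count≤1 [] _ = z≤n
    count≤1 {x ∷ xs} (x≢xs ∷ unique) P-subsingleton with P? x
    ... | yes px = s≤s (≤-reflexive (cong length (filter-none P? (All.map rest-fails x≢xs))))
      where
      rest-fails : ∀ {y} → x ≢ y → ¬ P y
      rest-fails x≢y py = x≢y (P-subsingleton px py)
    ... | no _ = count≤1 unique P-subsingleton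

  module _ {P Q R : Pred A 0ℓ} (P? : Decidable P) (Q? : Decidable Q) (R? : Decidable R) where

    count-subadditive : P ⊆ Q ∪ R → ∀ xs → count P? xs ≤ count Q? xs + count R? xs
    count-subadditive P⊆Q∪R [] = z≤n
    count-subadditive P⊆Q∪R (x ∷ xs) with P? x | count-subadditive P⊆Q∪R xs
    ... | no _ | ih = ≤-trans ih (+-mono-≤ (count-≤-∷ Q? x xs) (count-≤-∷ R? x xs))
    ... | yes p | ih with P⊆Q∪R p
    ...   | inj₁ q = begin
      suc (count P? xs)                        ≤⟨ s≤s (≤-trans ih (+-monoʳ-≤ _ (count-≤-∷ R? x xs))) ⟩
      suc (count Q? xs) + count R? (x ∷ xs)    ≡⟨ cong (_+ _) (count-accept Q? xs q) ⟨
      count Q? (x ∷ xs) + count R? (x ∷ xs)    ∎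
      where open ≤-Reasoning
    ...   | inj₂ r = begin
      suc (count P? xs)                        ≤⟨ s≤s (≤-trans ih (+-monoˡ-≤ _ (count-≤-∷ Q? x xs))) ⟩
      suc (count Q? (x ∷ xs) + count R? xs)    ≡⟨ +-suc _ _ ⟨
      count Q? (x ∷ xs) + suc (count R? xs)    ≡⟨ cong (_ +_) (count-accept R? xs r) ⟨
      count Q? (x ∷ xs) + count R? (x ∷ xs)    ∎
      where open ≤-Reasoning

    count-disjoint : P ⊆ Q → R ⊆ Q → R ⊆ ∁ P → ∀ xs → count P? xs + count R? xs ≤ count Q? xs
    count-disjoint P⊆Q R⊆Q R⊆∁P [] = z≤n
    count-disjoint P⊆Q R⊆Q R⊆∁P (x ∷ xs) with P? x | R? x | count-disjoint P⊆Q R⊆Q R⊆∁P xs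
    ... | yes p | yes r | _  = contradiction p (R⊆∁P r)
    ... | yes p | no _  | ih = ≤-trans (s≤s ih) (≤-reflexive (sym (count-accept Q? xs (P⊆Q p))))
    ... | no _  | yes r | ih = begin
      count P? xs + suc (count R? xs)    ≡⟨ +-suc _ _ ⟩
      suc (count P? xs + count R? xs)    ≤⟨ s≤s ih ⟩
      suc (count Q? xs)                  ≡⟨ count-accept Q? xs (R⊆Q r) ⟨
      count Q? (x ∷ xs)                  ∎
      where open ≤-Reasoning
    ... | no _  | no _  | ih = ≤-trans ih (count-≤-∷ Q? x xs)

  injective⇒≤count : ∀ {k} {P : Pred A 0ℓ} (P? : Decidable P) {xs} (f : Fin k → A) → Injective _≡_ _≡_ f →
            (∀ a → f a ∈ xs) → (∀ a → P (f a)) → k ≤ count P? xs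
  injective⇒≤count P? {xs} f f-injective f∈xs P∘f = injective⇒≤ position-injective
    where
    f∈filter : ∀ a → f a ∈ filter P? xs
    f∈filter a = ∈-filter⁺ P? (f∈xs a) (P∘f a)
    position-injective : Injective _≡_ _≡_ (index ∘ f∈filter)
    position-injective {a} {b} e = f-injective (begin
      f a                                        ≡⟨ lookup-index (f∈filter a) ⟩
      lookup (filter P? xs) (index (f∈filter a)) ≡⟨ cong (lookup (filter P? xs)) e ⟩
      lookup (filter P? xs) (index (f∈filter b)) ≡⟨ lookup-index (f∈filter b) ⟨
      f b                                        ∎)
      where open ≡-Reasoning

count-allFin-≤ : ∀ {n} {P : Pred (Fin n) 0ℓ} (P? : Decidable P) → count P? (allFin n) ≤ n
count-allFin-≤ {n} P? = ≤-trans (length-filter P? (allFin n)) (≤-reflexive (length-tabulate {n = n} (λ i → i)))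

module _ {n : ℕ} where

  Differ : Permutation′ n → Permutation′ n → Pred (Fin n) 0ℓ
  Differ σ τ i = σ ⟨$⟩ʳ i ≢ τ ⟨$⟩ʳ i

  differ? : (σ τ : Permutation′ n) → Decidable (Differ σ τ)
  differ? σ τ i = ¬? (σ ⟨$⟩ʳ i ≟ τ ⟨$⟩ʳ i)

  hamming-self : (σ : Permutation′ n) → hamming σ σ ≡ 0
  hamming-self σ = cong length (filter-none (differ? σ σ) (All.universal (λ _ differ → differ refl) (allFin n)))

  hamming-triangle : (σ π ρ : Permutation′ n) → hamming σ ρ ≤ hamming σ π + hamming π ρ
  hamming-triangle σ π ρ = count-subadditive (differ? σ ρ) (differ? σ π) (differ? π ρ) through-π (allFin n)
    where
    through-π : Differ σ ρ ⊆ Differ σ π ∪ Differ π ρ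
    through-π {i} σi≢ρi with σ ⟨$⟩ʳ i ≟ π ⟨$⟩ʳ i
    ... | yes σi≡πi = inj₂ (σi≢ρi ∘ trans σi≡πi)
    ... | no σi≢πi = inj₁ σi≢πi

  transpose-sends-left : (x y : Fin n) → PC.transpose x y x ≡ y
  transpose-sends-left x y with x ≟ x
  ... | yes _ = refl
  ... | no x≢x = contradiction refl x≢x

  transpose-fixes : ∀ {x y q : Fin n} → q ≢ x → q ≢ y → PC.transpose x y q ≡ q
  transpose-fixes {x} {y} {q} q≢x q≢y with q ≟ x
  ... | yes q≡x = contradiction q≡x q≢x
  ... | no _ with q ≟ y
  ...   | yes q≡y = contradiction q≡y q≢y
  ...   | no _ = refl

  transpose-moves : ∀ {x y q : Fin n} → PC.transpose x y q ≢ q → q ≡ x ⊎ q ≡ y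
  transpose-moves {x} {y} {q} moved with q ≟ x
  ... | yes q≡x = inj₁ q≡x
  ... | no _ with q ≟ y
  ...   | yes q≡y = inj₂ q≡y
  ...   | no _ = contradiction refl moved

  hamming-∘ₚ-transpose : (π : Permutation′ n) (x y : Fin n) → hamming π (transpose x y ∘ₚ π) ≤ 2
  hamming-∘ₚ-transpose π x y = begin
    hamming π π′                                        ≤⟨ count-subadditive (differ? π π′) (_≟ x) (_≟ y) moved (allFin n) ⟩
    count (_≟ x) (allFin n) + count (_≟ y) (allFin n)   ≤⟨ +-mono-≤ (at-most-one x) (at-most-one y) ⟩
    2                                                   ∎
    where
    open ≤-Reasoning
    π′ : Permutation′ n
    π′ = transpose x y ∘ₚ π
    moved : Differ π π′ ⊆ (_≡ x) ∪ (_≡ y)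
    moved π≢ = transpose-moves (π≢ ∘ cong (π ⟨$⟩ʳ_) ∘ sym)
    at-most-one : ∀ a → count (_≟ a) (allFin n) ≤ 1
    at-most-one a = count≤1 (_≟ a) (allFin⁺ n) (λ x≡a y≡a → trans x≡a (sym y≡a))

  module _ (π : Permutation′ n) where

    iter-+ : ∀ a b p → iter π (a + b) p ≡ iter π a (iter π b p)
    iter-+ zero b p = refl
    iter-+ (suc a) b p = cong (π ⟨$⟩ʳ_) (iter-+ a b p)

    iter-comm : ∀ a b p → iter π a (iter π b p) ≡ iter π b (iter π a p)
    iter-comm a b p = begin
      iter π a (iter π b p) ≡⟨ iter-+ a b p ⟨
      iter π (a + b) p      ≡⟨ cong (λ c → iter π c p) (+-comm a b) ⟩
      iter π (b + a) p      ≡⟨ iter-+ b a p ⟩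
      iter π b (iter π a p) ∎
      where open ≡-Reasoning

    iter-injective : ∀ a {p q} → iter π a p ≡ iter π a q → p ≡ q
    iter-injective zero e = e
    iter-injective (suc a) {p} {q} e = iter-injective a (begin
      iter π a p                     ≡⟨ inverseˡ π ⟨
      π ⟨$⟩ˡ (π ⟨$⟩ʳ iter π a p)     ≡⟨ cong (π ⟨$⟩ˡ_) e ⟩
      π ⟨$⟩ˡ (π ⟨$⟩ʳ iter π a q)     ≡⟨ inverseˡ π ⟩
      iter π a q                     ∎)
      where open ≡-Reasoning

    iter-agree : ∀ (ρ : Permutation′ n) p t →
                 (∀ s → s < t → ρ ⟨$⟩ʳ iter π s p ≡ π ⟨$⟩ʳ iter π s p) → iter ρ t p ≡ iter π t p
    iter-agree ρ p zero agree = refl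
    iter-agree ρ p (suc t) agree = begin
      ρ ⟨$⟩ʳ iter ρ t p   ≡⟨ cong (ρ ⟨$⟩ʳ_) (iter-agree ρ p t (λ s s<t → agree s (m≤n⇒m≤1+n s<t))) ⟩
      ρ ⟨$⟩ʳ iter π t p   ≡⟨ agree t ≤-refl ⟩
      π ⟨$⟩ʳ iter π t p   ∎
      where open ≡-Reasoning

  CycleLength≤ : Permutation′ n → ℕ → Pred (Fin n) 0ℓ
  CycleLength≤ π k p = ∃ λ l → l < k × iter π (suc l) p ≡ p

  cycleLength≤? : (π : Permutation′ n) (k : ℕ) → Decidable (CycleLength≤ π k)
  cycleLength≤? π k p = anyUpTo? (λ l → iter π (suc l) p ≟ p) k

  #CycleLength≤ : Permutation′ n → ℕ → ℕ
  #CycleLength≤ π k = count (cycleLength≤? π k) (allFin n)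

  module _ {π : Permutation′ n} {k : ℕ} where

    cycleLength≤-iter : ∀ {p} s → CycleLength≤ π k p → CycleLength≤ π k (iter π s p)
    cycleLength≤-iter {p} s (l , l<k , returns) = l , l<k , trans (iter-comm π (suc l) s p) (cong (iter π s) returns)

    cycleLength≤-iter⁻ : ∀ {p} s → CycleLength≤ π k (iter π s p) → CycleLength≤ π k p
    cycleLength≤-iter⁻ {p} s (l , l<k , returns) = l , l<k , iter-injective π s (trans (iter-comm π s (suc l) p) returns)

    collision⇒cycleLength≤ : ∀ {p a b} → a < b → b < k → iter π a p ≡ iter π b p → CycleLength≤ π k p
    collision⇒cycleLength≤ {p} {a} {b} a<b b<k e with o , 1+a+o≡b ← m≤n⇒∃[o]m+o≡n a<b =
      o , ≤-trans (s≤s (m≤n+m o a)) (≤-trans (≤-reflexive 1+a+o≡b) (<⇒≤ b<k)) , iter-injective π a (begin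
        iter π a (iter π (suc o) p) ≡⟨ iter-+ π a (suc o) p ⟨
        iter π (a + suc o) p        ≡⟨ cong (λ c → iter π c p) (trans (+-suc a o) 1+a+o≡b) ⟩
        iter π b p                  ≡⟨ e ⟨
        iter π a p                  ∎)
      where open ≡-Reasoning

    iter-injective-below : ∀ {p a b} → ¬ CycleLength≤ π k p → a < k → b < k → iter π a p ≡ iter π b p → a ≡ b
    iter-injective-below {a = a} {b} long a<k b<k e with <-cmp a b
    ... | tri< a<b _ _ = contradiction (collision⇒cycleLength≤ a<b b<k e) long
    ... | tri≈ _ a≡b _ = a≡b
    ... | tri> _ _ b<a = contradiction (collision⇒cycleLength≤ b<a a<k (sym e)) long

search-≤ : ∀ {n} (π : Permutation′ n) p start fuel {l} → start ≤ l → l < start + fuel → iter π l p ≡ p →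
           search π p start fuel ≤ l
search-≤ π p start zero start≤l l<start+0 _ =
  contradiction (subst (_ <_) (+-identityʳ start) l<start+0) (≤⇒≯ start≤l)
search-≤ π p start (suc fuel) {l} start≤l l<end returns with iter π start p ≟ p
... | yes _ = start≤l
... | no start-fails with m≤n⇒m<n∨m≡n start≤l
...   | inj₁ start<l = search-≤ π p (suc start) fuel start<l (subst (l <_) (+-suc start fuel) l<end) returns
...   | inj₂ refl = contradiction returns start-fails

cycleLength-≤ : ∀ {n} {π : Permutation′ n} {k p} → k ≤ n → CycleLength≤ π k p → cycleLength π p ≤ k
cycleLength-≤ {n} {π} {p = p} k≤n (l , l<k , returns) =
  ≤-trans (search-≤ π p 1 n (s≤s z≤n) (s≤s (≤-trans l<k k≤n)) returns) l<k

w-≤ : ∀ {n} {π : Permutation′ n} {k} → (Fin n → k ≤ n) → (∀ p → CycleLength≤ π k p) → w π ≤ k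
w-≤ {n} {k = k} k≤n short = foldr-preservesᵇ {P = _≤ k} {f = _⊔_} ⊔-lub z≤n
  (map⁺ (All.universal (λ p → cycleLength-≤ (k≤n p) (short p)) (allFin n)))

module Split {n} (π : Permutation′ n) (k′ : ℕ) (i : Fin n) (long : ¬ CycleLength≤ π (suc k′) i) where

  k : ℕ
  k = suc k′

  x y : Fin n
  x = iter π k′ i
  y = π ⟨$⟩ˡ i

  π′ : Permutation′ n
  π′ = transpose x y ∘ₚ π

  π′-closes-arc : π′ ⟨$⟩ʳ x ≡ i
  π′-closes-arc = trans (cong (π ⟨$⟩ʳ_) (transpose-sends-left x y)) (inverseʳ π)

  π′-elsewhere : ∀ {q} → q ≢ x → q ≢ y → π′ ⟨$⟩ʳ q ≡ π ⟨$⟩ʳ q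
  π′-elsewhere q≢x q≢y = cong (π ⟨$⟩ʳ_) (transpose-fixes q≢x q≢y)

  short-≢x : ∀ {q} → CycleLength≤ π k q → q ≢ x
  short-≢x short refl = long (cycleLength≤-iter⁻ k′ short)

  short-≢y : ∀ {q} → CycleLength≤ π k q → q ≢ y
  short-≢y short refl = long (subst (CycleLength≤ π k) (inverseʳ π) (cycleLength≤-iter {π = π} 1 short))

  π′-agrees-on-short : ∀ {p} → CycleLength≤ π k p → ∀ s → iter π′ s p ≡ iter π s p
  π′-agrees-on-short {p} short s = iter-agree π π′ p s (λ r _ →
    π′-elsewhere (short-≢x (cycleLength≤-iter r short)) (short-≢y (cycleLength≤-iter r short)))

  short-preserved : CycleLength≤ π k ⊆ CycleLength≤ π′ k
  short-preserved short@(l , l<k , returns) = l , l<k , trans (π′-agrees-on-short short (suc l)) returns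

  fixSubset : FixSubset π π′
  fixSubset p πp≡p = trans (π′-agrees-on-short (0 , s≤s z≤n , πp≡p) 1) πp≡p

  hamming-≤2 : hamming π π′ ≤ 2
  hamming-≤2 = hamming-∘ₚ-transpose π x y

  arc-agrees : ∀ j → j ≤ k′ → iter π′ j i ≡ iter π j i
  arc-agrees j j≤k′ = iter-agree π π′ i j (λ s s<j → π′-elsewhere (arc-≢x s<j) (arc-≢y (≤-trans s<j j≤k′)))
    where
    arc-≢x : ∀ {s} → s < j → iter π s i ≢ x
    arc-≢x {s} s<j e =
      <⇒≢ (≤-trans s<j j≤k′) (iter-injective-below long (s≤s (≤-trans (<⇒≤ s<j) j≤k′)) ≤-refl e)
    arc-≢y : ∀ {s} → s < k′ → iter π s i ≢ y
    arc-≢y {s} s<k′ e = long (s , m≤n⇒m≤1+n s<k′ , trans (cong (π ⟨$⟩ʳ_) e) (inverseʳ π))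

  i-short′ : CycleLength≤ π′ k i
  i-short′ = k′ , ≤-refl , trans (cong (π′ ⟨$⟩ʳ_) (arc-agrees k′ ≤-refl)) π′-closes-arc

  NewlyShort : Pred (Fin n) 0ℓ
  NewlyShort = CycleLength≤ π′ k ∩ ∁ (CycleLength≤ π k)

  newlyShort? : Decidable NewlyShort
  newlyShort? = cycleLength≤? π′ k ∩? ∁? (cycleLength≤? π k)

  k≤#NewlyShort : k ≤ count newlyShort? (allFin n)
  k≤#NewlyShort = injective⇒≤count newlyShort? arc arc-injective (λ _ → ∈-allFin _) on-arc
    where
    arc : Fin k → Fin n
    arc a = iter π (toℕ a) i
    arc-injective : Injective _≡_ _≡_ arc
    arc-injective {a} {b} e = toℕ-injective (iter-injective-below long (toℕ<n a) (toℕ<n b) e)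
    on-arc : ∀ a → NewlyShort (arc a)
    on-arc a =
        subst (CycleLength≤ π′ k) (arc-agrees (toℕ a) (≤-pred (toℕ<n a))) (cycleLength≤-iter (toℕ a) i-short′)
      , long ∘ cycleLength≤-iter⁻ (toℕ a)

  #CycleLength≤-grows : #CycleLength≤ π k + k ≤ #CycleLength≤ π′ k
  #CycleLength≤-grows = ≤-trans (+-monoʳ-≤ (#CycleLength≤ π k) k≤#NewlyShort)
    (count-disjoint (cycleLength≤? π k) (cycleLength≤? π′ k) newlyShort? short-preserved proj₁ proj₂ (allFin n))

module _ {n : ℕ} (k′ : ℕ) where

  private
    k : ℕ
    k = suc k′

  Shortening : Permutation′ n → Permutation′ n → Set
  Shortening σ τ = FixSubset σ τ × (∀ p → CycleLength≤ τ k p) × k * hamming σ τ ≤ 2 * n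

  shorten : ∀ fuel (σ π : Permutation′ n) → FixSubset σ π → k * hamming σ π ≤ 2 * #CycleLength≤ π k →
            n < fuel + #CycleLength≤ π k → Σ (Permutation′ n) (Shortening σ)
  shorten fuel σ π σ⊆π bound progress with all? (cycleLength≤? π k)
  ... | yes all-short = π , σ⊆π , all-short , ≤-trans bound (*-monoʳ-≤ 2 (count-allFin-≤ (cycleLength≤? π k)))
  shorten zero σ π _ _ progress | no _ = contradiction (count-allFin-≤ (cycleLength≤? π k)) (<⇒≱ progress)
  shorten (suc fuel) σ π σ⊆π bound progress | no not-all
    with i , long ← ¬∀⟶∃¬ n (CycleLength≤ π k) (cycleLength≤? π k) not-all =
    shorten fuel σ π′ (λ p → fixSubset p ∘ σ⊆π p) bound′ progress′
    where
    open Split π k′ i long using (π′; fixSubset; hamming-≤2; #CycleLength≤-grows)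
    bound′ : k * hamming σ π′ ≤ 2 * #CycleLength≤ π′ k
    bound′ = begin
      k * hamming σ π′                      ≤⟨ *-monoʳ-≤ k (hamming-triangle σ π π′) ⟩
      k * (hamming σ π + hamming π π′)      ≤⟨ *-monoʳ-≤ k (+-monoʳ-≤ (hamming σ π) hamming-≤2) ⟩
      k * (hamming σ π + 2)                 ≡⟨ *-distribˡ-+ k (hamming σ π) 2 ⟩
      k * hamming σ π + k * 2               ≤⟨ +-monoˡ-≤ (k * 2) bound ⟩
      2 * #CycleLength≤ π k + k * 2         ≡⟨ cong (2 * #CycleLength≤ π k +_) (*-comm k 2) ⟩
      2 * #CycleLength≤ π k + 2 * k         ≡⟨ *-distribˡ-+ 2 (#CycleLength≤ π k) k ⟨
      2 * (#CycleLength≤ π k + k)           ≤⟨ *-monoʳ-≤ 2 #CycleLength≤-grows ⟩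
      2 * #CycleLength≤ π′ k                ∎
      where open ≤-Reasoning
    progress′ : n < fuel + #CycleLength≤ π′ k
    progress′ = begin-strict
      n                                     <⟨ progress ⟩
      suc fuel + #CycleLength≤ π k          ≡⟨ +-suc fuel _ ⟨
      fuel + suc (#CycleLength≤ π k)        ≤⟨ +-monoʳ-≤ fuel (m<m+n _ (s≤s z≤n)) ⟩
      fuel + (#CycleLength≤ π k + k)        ≤⟨ +-monoʳ-≤ fuel #CycleLength≤-grows ⟩
      fuel + #CycleLength≤ π′ k             ∎
      where open ≤-Reasoning

  shortenCycles : (σ : Permutation′ n) → Σ (Permutation′ n) (Shortening σ)
  shortenCycles σ = shorten (suc n) σ σ (λ _ σp≡p → σp≡p) initial (s≤s (m≤m+n n _))
    where
    initial : k * hamming σ σ ≤ 2 * #CycleLength≤ σ k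
    initial = ≤-trans (≤-reflexive (trans (cong (k *_) (hamming-self σ)) (*-zeroʳ k))) z≤n

lemma5p3 : (m n : ℕ) → m ∣ n → (k : ℕ) → 1 ≤ k → k ≤ m →
    (σ : Permutation′ n) →
    Σ (Permutation′ n) (λ τ → FixSubset σ τ × w τ ≤ k × k * hamming σ τ ≤ 8 * n)
lemma5p3 m n m∣n (suc k′) _ k≤m σ with τ , σ⊆τ , all-short , bound ← shortenCycles k′ σ =
  τ , σ⊆τ , w-≤ k≤n all-short , ≤-trans bound (*-monoˡ-≤ n {2} {8} (s≤s (s≤s z≤n)))
  where
  -- m ∣ n only serves to bound k by n, so that the bounded search in cycleLength reaches the return.
  k≤n : Fin n → suc k′ ≤ n
  k≤n p = ≤-trans k≤m (∣⇒≤ {{nonZeroIndex p}} m∣n)
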